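{- Let $G$ be a finite abelian group (written additively, identity $0$) and let $k\geq 2$ be an integer. The following are equivalent: (i) $G$ admits an orthomorphism fixing $0$ and permuting the elements of $G\setminus\{0\}$ as a product of disjoint $k$-cycles; (ii) $\vec{K}_G[G\setminus\{0\};G\setminus\{0\}]$ contains a rainbow $\vec{C}_k$-factor; (iii) $\mathcal{H}_k[G\setminus\{0\};G\setminus\{0\}]$ has a perfect matching.
   Context: An orthomorphism of $G$ is a bijection $\phi\colon G\to G$ such that $g\mapsto \phi(g)-g$ is also a bijection. $\vec{K}_G$ is the edge-coloured directed graph with vertex set $G$, edge set $\{(a,b)\in G\times G: a\neq b\}$, where edge $(a,b)$ has colour $a-b$. For $V,C\subseteq G$, $\vec{K}_G[V;C]$ is the subgraph with vertex set $V$ keeping only edges between vertices of $V$ whose colours lie in $C$. A subgraph is rainbow if all its edges have distinct colours. $\vec{C}_k$ is a directed cycle with $k$ vertices and $k$ edges; a rainbow $\vec{C}_k$-factor is a collection of vertex-disjoint directed $k$-cycles covering all vertices such that all edges of the collection have distinct colours. $\mathcal{H}_k[V;C]$ is the $2k$-uniform hypergraph on the vertex set $V\sqcup C$ (disjoint union) in which $v\sqcup c$ (with $v\subseteq V$, $c\subseteq C$) is an edge whenever $v$ is the vertex set of a rainbow directed cycle of length $k$ in $\vec{K}_G$ whose colour set is precisely $c$. A perfect matching is a set of pairwise disjoint edges covering every vertex of the hypergraph. -}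

module Defs where

open import Data.Nat using (ℕ; zero; suc; _≤_; _<_)
open import Data.Nat.DivMod using (_mod_)
open import Data.Fin using (Fin; toℕ)
open import Data.Fin.Subset using (Subset; _∈_; _∉_; _⊆_; ∁; ⁅_⁆)
open import Data.Product using (Σ; ∃; _×_; _,_)
open import Relation.Binary.PropositionalEquality using (_≡_; _≢_)
open import Relation.Nullary using (¬_)
open import Algebra.Structures using (IsAbelianGroup)
open import Function.Definitions using (Bijective; Injective)

-- A finite abelian group, written additively, with carrier Fin n
-- (every finite abelian group is isomorphic to one of this form).

record FinAbGroup : Set where
  infixl 6 _+_ _-_
  field
    n              : ℕ
    _+_            : Fin n → Fin n → Fin n
    0#             : Fin n
    -_             : Fin n → Fin n
    isAbelianGroup : IsAbelianGroup _≡_ _+_ 0# -_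

  _-_ : Fin n → Fin n → Fin n
  a - b = a + (- b)

  G∖0 : Subset n
  G∖0 = ∁ ⁅ 0# ⁆

open FinAbGroup public

iter : {A : Set} → ℕ → (A → A) → A → A
iter zero    f x = x
iter (suc j) f x = f (iter j f x)

sucMod : {k : ℕ} → Fin k → Fin k
sucMod {suc k} i = suc (toℕ i) mod suc k

module _ (G : FinAbGroup) where
  private
    Carrier = Fin (n G)
    _−_ = _-_ G

  IsOrthomorphism : (Carrier → Carrier) → Set
  IsOrthomorphism φ =
    Bijective _≡_ _≡_ φ × Bijective _≡_ _≡_ (λ g → φ g − g)

  -- φ fixes 0 and permutes G ∖ {0} as a product of disjoint k-cycles:
  -- every nonzero g lies on a cycle of φ of length exactly k.
  ProductOfKCycles : ℕ → (Carrier → Carrier) → Set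
  ProductOfKCycles k φ =
    φ (0# G) ≡ 0# G ×
    (∀ g → g ≢ 0# G →
       iter k φ g ≡ g × (∀ j → 1 ≤ j → j < k → iter j φ g ≢ g))

  HasOrthomorphismKCycles : ℕ → Set
  HasOrthomorphismKCycles k =
    Σ (Carrier → Carrier) λ φ → IsOrthomorphism φ × ProductOfKCycles k φ

  colour : Carrier → Carrier → Carrier
  colour a b = a − b

  IsEdge : Subset (n G) → Subset (n G) → Carrier → Carrier → Set
  IsEdge V C a b = a ∈ V × b ∈ V × a ≢ b × colour a b ∈ C

  IsDirectedCycle : (k : ℕ) → Subset (n G) → Subset (n G) → (Fin k → Carrier) → Set
  IsDirectedCycle k V C v =
    Injective _≡_ _≡_ v × (∀ i → IsEdge V C (v i) (v (sucMod i)))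

  -- A rainbow C_k-factor of K_G[V;C]: m vertex-disjoint directed k-cycles
  -- covering V, all of whose edges have pairwise distinct colours.
  -- cyc j i is the i-th vertex of the j-th cycle.
  record RainbowFactor (k : ℕ) (V C : Subset (n G)) : Set where
    field
      m        : ℕ
      cyc      : Fin m → Fin k → Carrier
      isCycle  : ∀ j → IsDirectedCycle k V C (cyc j)
      disjoint : ∀ j j' i i' → cyc j i ≡ cyc j' i' → j ≡ j'
      covers   : ∀ x → x ∈ V → ∃ λ j → ∃ λ i → cyc j i ≡ x
      rainbow  : ∀ j j' i i' →
                 colour (cyc j i) (cyc j (sucMod i)) ≡
                   colour (cyc j' i') (cyc j' (sucMod i')) →
                 (j ≡ j' × i ≡ i')

-- (iii) The 2k-uniform hypergraph H_k[V;C] on V ⊔ C.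
-- A subset of V ⊔ C is a pair (v , c) with v ⊆ V, c ⊆ C
-- (v the part in V, c the part in C).

  IsRainbowCycle : (k : ℕ) → (Fin k → Carrier) → Set
  IsRainbowCycle k w =
    IsDirectedCycle k all all w ×
    Injective _≡_ _≡_ (λ i → colour (w i) (w (sucMod i)))
    where
      open import Data.Fin.Subset using (⊤)
      all : Subset (n G)
      all = ⊤

  IsHyperedge : (k : ℕ) → (V C : Subset (n G)) → Subset (n G) × Subset (n G) → Set
  IsHyperedge k V C (v , c) =
    v ⊆ V × c ⊆ C ×
    Σ (Fin k → Carrier) λ w →
      IsRainbowCycle k w ×
      (∀ x → x ∈ v → ∃ λ i → w i ≡ x) × (∀ i → w i ∈ v) ×
      (∀ x → x ∈ c → ∃ λ i → colour (w i) (w (sucMod i)) ≡ x) ×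
      (∀ i → colour (w i) (w (sucMod i)) ∈ c)

  record PerfectMatching (k : ℕ) (V C : Subset (n G)) : Set where
    field
      m         : ℕ
      edge      : Fin m → Subset (n G) × Subset (n G)
      isEdge    : ∀ j → IsHyperedge k V C (edge j)
      disjointV : ∀ j j' x → x ∈ Data.Product.proj₁ (edge j) →
                  x ∈ Data.Product.proj₁ (edge j') → j ≡ j'
      disjointC : ∀ j j' x → x ∈ Data.Product.proj₂ (edge j) →
                  x ∈ Data.Product.proj₂ (edge j') → j ≡ j'
      coversV   : ∀ x → x ∈ V → ∃ λ j → x ∈ Data.Product.proj₁ (edge j)
      coversC   : ∀ x → x ∈ C → ∃ λ j → x ∈ Data.Product.proj₂ (edge j)

module Submission where

-- A rainbow C_k-factor on G ∖ {0} is the cycle decomposition of a permutation φ of G fixing 0: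
-- φ sends each vertex to its successor on its cycle, and the arc x → φ x has colour
-- x - φ x = -(φ x - x). Distinct arcs have distinct colours exactly when g ↦ φ g - g is
-- injective, i.e. when φ is an orthomorphism; conversely, the cycles of an orthomorphism are
-- listed by choosing one representative per orbit. A rainbow factor gives a perfect matching
-- of H_k as soon as its colours exhaust G ∖ {0}, and this is forced because g ↦ φ g - g is a
-- bijection of G fixing 0.

open import Defs hiding (_+_; _-_; -_)
open import Algebra.Bundles using (Group)
open import Algebra.Structures using (module IsAbelianGroup)
import Algebra.Properties.Group as GroupProperties
open import Data.Bool using (true)
open import Data.Empty using (⊥-elim)
open import Data.Fin as Fin using (Fin; toℕ; fromℕ<; punchOut)
open import Data.Fin.Properties
  using (toℕ-injective; toℕ-fromℕ<; toℕ<n; any?; all?; _≟_; punchOut-injective; injective⇒≤)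
open import Data.Fin.Subset using (Subset; _∈_)
open import Data.Fin.Subset.Properties
  using (x∈⁅x⁆; x∈⁅y⁆⇒x≡y; x∈∁p⇒x∉p; x∉p⇒x∈∁p; ∈⊤)
open import Data.List using (List; _∷_; filter; allFin; length; lookup)
open import Data.List.Membership.Propositional.Properties
  using (∈-lookup; ∈-filter⁺; ∈-filter⁻; ∈-allFin)
open import Data.List.Relation.Unary.All as All using ()
open import Data.List.Relation.Unary.AllPairs using (_∷_)
import Data.List.Relation.Unary.Any as Any
open import Data.List.Relation.Unary.Any.Properties using (lookup-index)
open import Data.List.Relation.Unary.Unique.Propositional using (Unique)
open import Data.List.Relation.Unary.Unique.Propositional.Properties using (filter⁺; allFin⁺)
open import Data.Nat using (ℕ; zero; suc; _+_; _*_; _∸_; _%_; _/_; _≤_; _<_; NonZero; _≤?_)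
open import Data.Nat.DivMod
  using (m≡m%n+[m/n]*n; m%n<n; m<n⇒m%n≡m; %-distribˡ-+; m%n%n≡m%n; [m+n]%n≡m%n)
open import Data.Nat.Properties
  using (≤-refl; ≤-trans; <-irrefl; <⇒≤; ≰⇒>; ≤-antisym; <-cmp; ≤-<-trans; +-identityʳ; +-suc;
         +-cancelˡ-≡; m≤m+n; m∸n≤m; m<n⇒0<n∸m; m+[n∸m]≡n; m∸n+n≡m)
open import Data.Product using (∃; ∃₂; _×_; _,_; proj₁; proj₂)
open import Data.Vec using (tabulate)
open import Data.Vec.Properties using ([]=⇒lookup; lookup⇒[]=; lookup∘tabulate)
open import Function.Bundles using (_⇔_; mk⇔)
open import Function.Consequences.Propositional using (strictlySurjective⇒surjective)
open import Function.Definitions using (Injective; Bijective)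
open import Relation.Binary.Definitions using (tri<; tri≈; tri>)
open import Relation.Binary.PropositionalEquality
  using (_≡_; _≢_; refl; sym; trans; cong; subst; module ≡-Reasoning)
open import Relation.Nullary using (yes; no; does)
open import Relation.Nullary.Decidable using (¬?; _×-dec_)
open import Relation.Unary using (Pred; Decidable)
open import Level using (0ℓ)

private
  variable
    A : Set

iter-+ : ∀ a b (f : A → A) x → iter (a + b) f x ≡ iter a f (iter b f x)
iter-+ zero    b f x = refl
iter-+ (suc a) b f x = cong f (iter-+ a b f x)

iter-suc : ∀ a (f : A → A) x → iter (suc a) f x ≡ iter a f (f x)
iter-suc zero    f x = refl
iter-suc (suc a) f x = cong f (iter-suc a f x)

iter-injective : ∀ a {f : A → A} → Injective _≡_ _≡_ f → Injective _≡_ _≡_ (iter a f)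
iter-injective zero    f-inj e = e
iter-injective (suc a) f-inj e = iter-injective a f-inj (f-inj e)

iter-preserves : ∀ a {P : A → Set} {f : A → A} →
                 (∀ {x} → P x → P (f x)) → ∀ {x} → P x → P (iter a f x)
iter-preserves zero    f-pres Px = Px
iter-preserves (suc a) {P} f-pres Px = f-pres (iter-preserves a {P} f-pres Px)

iter-natural : ∀ a {B : Set} {f : A → A} {g : B → B} (h : B → A) →
               (∀ y → f (h y) ≡ h (g y)) → ∀ y → iter a f (h y) ≡ h (iter a g y)
iter-natural zero    h comm y = refl
iter-natural (suc a) {f = f} h comm y = trans (cong f (iter-natural a h comm y)) (comm _)

module _ {f : A → A} {x : A} (K : ℕ) (period : iter K f x ≡ x) where

  iter-*-period : ∀ q → iter (q * K) f x ≡ x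
  iter-*-period zero    = refl
  iter-*-period (suc q) = trans (iter-+ K (q * K) f x) (trans (cong (iter K f) (iter-*-period q)) period)

  iter-% : .{{_ : NonZero K}} → ∀ a → iter a f x ≡ iter (a % K) f x
  iter-% a = begin
    iter a f x                              ≡⟨ cong (λ t → iter t f x) (m≡m%n+[m/n]*n a K) ⟩
    iter (a % K + (a / K) * K) f x          ≡⟨ iter-+ (a % K) _ f x ⟩
    iter (a % K) f (iter ((a / K) * K) f x) ≡⟨ cong (iter (a % K) f) (iter-*-period (a / K)) ⟩
    iter (a % K) f x                        ∎
    where open ≡-Reasoning

-- From the common point iter b f y, the remaining K ∸ b steps of the cycle of y lead back to y.
iter-rewind : ∀ {f : A → A} K {x y} a b → b ≤ K → iter K f y ≡ y →
              iter a f x ≡ iter b f y → iter (K ∸ b + a) f x ≡ y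
iter-rewind {f = f} K {x} {y} a b b≤K period e = begin
  iter (K ∸ b + a) f x          ≡⟨ iter-+ (K ∸ b) a f x ⟩
  iter (K ∸ b) f (iter a f x)   ≡⟨ cong (iter (K ∸ b) f) e ⟩
  iter (K ∸ b) f (iter b f y)   ≡⟨ sym (iter-+ (K ∸ b) b f y) ⟩
  iter (K ∸ b + b) f y          ≡⟨ cong (λ t → iter t f y) (m∸n+n≡m b≤K) ⟩
  iter K f y                    ≡⟨ period ⟩
  y                             ∎
  where open ≡-Reasoning

orbit-distinct : ∀ {K} {f : A → A} {x} → Injective _≡_ _≡_ f →
                 (∀ t → 1 ≤ t → t < K → iter t f x ≢ x) →
                 ∀ (i j : Fin K) → toℕ i < toℕ j → iter (toℕ i) f x ≢ iter (toℕ j) f x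
orbit-distinct {f = f} {x} f-inj aperiodic i j i<j e =
  aperiodic (toℕ j ∸ toℕ i) (m<n⇒0<n∸m i<j) (≤-<-trans (m∸n≤m (toℕ j) (toℕ i)) (toℕ<n j))
    (sym (iter-injective (toℕ i) f-inj (begin
      iter (toℕ i) f x                           ≡⟨ e ⟩
      iter (toℕ j) f x                           ≡⟨ cong (λ t → iter t f x) (sym (m+[n∸m]≡n (<⇒≤ i<j))) ⟩
      iter (toℕ i + (toℕ j ∸ toℕ i)) f x         ≡⟨ iter-+ (toℕ i) (toℕ j ∸ toℕ i) f x ⟩
      iter (toℕ i) f (iter (toℕ j ∸ toℕ i) f x)  ∎)))
  where open ≡-Reasoning

orbit-injective : ∀ {K} {f : A → A} {x} → Injective _≡_ _≡_ f →
                  (∀ t → 1 ≤ t → t < K → iter t f x ≢ x) →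
                  Injective _≡_ _≡_ (λ (i : Fin K) → iter (toℕ i) f x)
orbit-injective f-inj aperiodic {i} {j} e with <-cmp (toℕ i) (toℕ j)
... | tri< i<j _ _ = ⊥-elim (orbit-distinct f-inj aperiodic i j i<j e)
... | tri≈ _ i≡j _ = toℕ-injective i≡j
... | tri> _ _ j<i = ⊥-elim (orbit-distinct f-inj aperiodic j i j<i (sym e))

injective⇒strictlySurjective : ∀ {m} {f : Fin m → Fin m} → Injective _≡_ _≡_ f →
                               ∀ y → ∃ λ x → f x ≡ y
injective⇒strictlySurjective {zero}          f-inj ()
injective⇒strictlySurjective {suc m} {f = f} f-inj y with any? (λ x → f x ≟ y)
... | yes found = found
... | no  missed = ⊥-elim (<-irrefl refl (injective⇒≤ punchOut-f-inj))
  where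
  avoids : ∀ x → y ≢ f x
  avoids x e = missed (x , sym e)
  punchOut-f-inj : Injective _≡_ _≡_ (λ x → punchOut (avoids x))
  punchOut-f-inj {a} {b} e = f-inj (punchOut-injective (avoids a) (avoids b) e)

injective⇒bijective : ∀ {m} {f : Fin m → Fin m} → Injective _≡_ _≡_ f → Bijective _≡_ _≡_ f
injective⇒bijective f-inj = f-inj , strictlySurjective⇒surjective (injective⇒strictlySurjective f-inj)

minimum-attained : ∀ {m} (f : Fin (suc m) → ℕ) → ∃ λ i → ∀ j → f i ≤ f j
minimum-attained {zero}  f = Fin.zero , λ { Fin.zero → ≤-refl }
minimum-attained {suc m} f with minimum-attained (λ j → f (Fin.suc j))
... | i , fi≤ with f Fin.zero ≤? f (Fin.suc i)
...   | yes f0≤fi = Fin.zero  , λ { Fin.zero → ≤-refl ; (Fin.suc j) → ≤-trans f0≤fi (fi≤ j) }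
...   | no  f0≰fi = Fin.suc i , λ { Fin.zero → <⇒≤ (≰⇒> f0≰fi) ; (Fin.suc j) → fi≤ j }

lookup-injective : (xs : List A) → Unique xs → Injective _≡_ _≡_ (lookup xs)
lookup-injective (x ∷ xs) (x∉xs ∷ u) {Fin.zero}  {Fin.zero}  e = refl
lookup-injective (x ∷ xs) (x∉xs ∷ u) {Fin.zero}  {Fin.suc j} e = ⊥-elim (All.lookup x∉xs (∈-lookup j) e)
lookup-injective (x ∷ xs) (x∉xs ∷ u) {Fin.suc i} {Fin.zero}  e =
  ⊥-elim (All.lookup x∉xs (∈-lookup i) (sym e))
lookup-injective (x ∷ xs) (x∉xs ∷ u) {Fin.suc i} {Fin.suc j} e = cong Fin.suc (lookup-injective xs u e)

image : ∀ {k m} → (Fin k → Fin m) → Subset m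
image f = tabulate λ x → does (any? λ i → f i ≟ x)

∈-image⁺ : ∀ {k m} (f : Fin k → Fin m) i → f i ∈ image f
∈-image⁺ f i = lookup⇒[]= (f i) _ (trans (lookup∘tabulate _ (f i)) found)
  where
  found : does (any? λ j → f j ≟ f i) ≡ true
  found with any? (λ j → f j ≟ f i)
  ... | yes _   = refl
  ... | no  f∉ = ⊥-elim (f∉ (i , refl))

∈-image⁻ : ∀ {k m} (f : Fin k → Fin m) {x} → x ∈ image f → ∃ λ i → f i ≡ x
∈-image⁻ f {x} x∈ with any? (λ i → f i ≟ x) | trans (sym (lookup∘tabulate _ x)) ([]=⇒lookup x∈)
... | yes found | _ = found
... | no  _     | ()

module _ {k : ℕ} where
  private
    K = suc k

  [1+m%n]%n≡[1+m]%n : ∀ m → suc (m % K) % K ≡ suc m % K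
  [1+m%n]%n≡[1+m]%n m = begin
    (1 + m % K) % K          ≡⟨ %-distribˡ-+ 1 (m % K) K ⟩
    (1 % K + m % K % K) % K  ≡⟨ cong (λ t → (1 % K + t) % K) (m%n%n≡m%n m K) ⟩
    (1 % K + m % K) % K      ≡⟨ sym (%-distribˡ-+ 1 m K) ⟩
    (1 + m) % K              ∎
    where open ≡-Reasoning

  toℕ-sucMod : (i : Fin K) → toℕ (sucMod i) ≡ suc (toℕ i) % K
  toℕ-sucMod i = toℕ-fromℕ< _

  toℕ-iter-sucMod : ∀ t (i : Fin K) → toℕ (iter t sucMod i) ≡ (toℕ i + t) % K
  toℕ-iter-sucMod zero    i = sym (trans (cong (_% K) (+-identityʳ (toℕ i))) (m<n⇒m%n≡m (toℕ<n i)))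
  toℕ-iter-sucMod (suc t) i = begin
    toℕ (sucMod (iter t sucMod i))   ≡⟨ toℕ-sucMod (iter t sucMod i) ⟩
    suc (toℕ (iter t sucMod i)) % K  ≡⟨ cong (λ u → suc u % K) (toℕ-iter-sucMod t i) ⟩
    suc ((toℕ i + t) % K) % K        ≡⟨ [1+m%n]%n≡[1+m]%n (toℕ i + t) ⟩
    suc (toℕ i + t) % K              ≡⟨ cong (_% K) (sym (+-suc (toℕ i) t)) ⟩
    (toℕ i + suc t) % K              ∎
    where open ≡-Reasoning

  iter-sucMod-period : (i : Fin K) → iter K sucMod i ≡ i
  iter-sucMod-period i = toℕ-injective (begin
    toℕ (iter K sucMod i)  ≡⟨ toℕ-iter-sucMod K i ⟩
    (toℕ i + K) % K        ≡⟨ [m+n]%n≡m%n (toℕ i) K ⟩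
    toℕ i % K              ≡⟨ m<n⇒m%n≡m (toℕ<n i) ⟩
    toℕ i                  ∎)
    where open ≡-Reasoning

  iter-sucMod-aperiodic : ∀ t → 1 ≤ t → t < K → (i : Fin K) → iter t sucMod i ≢ i
  iter-sucMod-aperiodic t 1≤t t<K i e = not-multiple ((toℕ i + t) / K) t≡q*K
    where
    t≡q*K : t ≡ (toℕ i + t) / K * K
    t≡q*K = +-cancelˡ-≡ (toℕ i) _ _ (trans (m≡m%n+[m/n]*n (toℕ i + t) K)
      (cong (_+ (toℕ i + t) / K * K) (trans (sym (toℕ-iter-sucMod t i)) (cong toℕ e))))
    not-multiple : ∀ q → t ≢ q * K
    not-multiple zero    refl = <-irrefl refl 1≤t
    not-multiple (suc q) refl = <-irrefl refl (≤-trans t<K (m≤m+n K (q * K)))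

  sucMod-injective : Injective _≡_ _≡_ (sucMod {K})
  sucMod-injective {i} {j} e = begin
    i                          ≡⟨ sym (iter-sucMod-period i) ⟩
    iter K sucMod i            ≡⟨ iter-suc k sucMod i ⟩
    iter k sucMod (sucMod i)   ≡⟨ cong (iter k sucMod) e ⟩
    iter k sucMod (sucMod j)   ≡⟨ sym (iter-suc k sucMod j) ⟩
    iter K sucMod j            ≡⟨ iter-sucMod-period j ⟩
    j                          ∎
    where open ≡-Reasoning

module _ (G : FinAbGroup) where
  private
    module G = FinAbGroup G
    group : Group 0ℓ 0ℓ
    group = record { isGroup = IsAbelianGroup.isGroup G.isAbelianGroup }
    open GroupProperties group

  colour≡0⇒≡ : ∀ a b → colour G a b ≡ G.0# → a ≡ b
  colour≡0⇒≡ = x∙y⁻¹≈ε⇒x≈y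

  colour-self : ∀ a → colour G a a ≡ G.0#
  colour-self a = x≈y⇒x∙y⁻¹≈ε refl

  -colour : ∀ a b → G.- colour G a b ≡ colour G b a
  -colour = ⁻¹-anti-homo-//

  -‿injective : Injective _≡_ _≡_ (λ x → G.- x)
  -‿injective = ⁻¹-injective

  -x≡0⇒x≡0 : ∀ {x} → G.- x ≡ G.0# → x ≡ G.0#
  -x≡0⇒x≡0 e = ⁻¹-injective (trans e (sym ε⁻¹≈ε))

  ∈G∖0⁺ : ∀ {x} → x ≢ G.0# → x ∈ G∖0 G
  ∈G∖0⁺ x≢0 = x∉p⇒x∈∁p (λ x∈⁅0⁆ → x≢0 (x∈⁅y⁆⇒x≡y _ x∈⁅0⁆))

  ∈G∖0⁻ : ∀ {x} → x ∈ G∖0 G → x ≢ G.0#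
  ∈G∖0⁻ x∈ refl = x∈∁p⇒x∉p x∈ (x∈⁅x⁆ _)

  arcColour : ∀ {k} → (Fin k → Fin (n G)) → Fin k → Fin (n G)
  arcColour w i = colour G (w i) (w (sucMod i))

module _ (G : FinAbGroup) {k : ℕ} {V C : Subset (n G)} where

  perfectMatching⇒rainbowFactor : PerfectMatching G k V C → RainbowFactor G k V C
  perfectMatching⇒rainbowFactor pm = record
    { m = m ; cyc = cycle ; isCycle = isCycle ; disjoint = disjoint ; covers = covers ; rainbow = rainbow }
    where
    open PerfectMatching pm

    cycle : Fin m → Fin k → Fin (n G)
    cycle j = let (_ , _ , w , _) = isEdge j in w

    vertex∈ : ∀ j i → cycle j i ∈ proj₁ (edge j)
    vertex∈ j = let (_ , _ , _ , _ , _ , w∈v , _) = isEdge j in w∈v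

    arcColour∈ : ∀ j i → arcColour G (cycle j) i ∈ proj₂ (edge j)
    arcColour∈ j = let (_ , _ , _ , _ , _ , _ , _ , c∈c) = isEdge j in c∈c

    isCycle : ∀ j → IsDirectedCycle G k V C (cycle j)
    isCycle j = let (v⊆V , c⊆C , _ , ((w-inj , arc) , _) , _) = isEdge j in
      w-inj , λ i → let (_ , _ , w≢w' , _) = arc i in
        v⊆V (vertex∈ j i) , v⊆V (vertex∈ j (sucMod i)) , w≢w' , c⊆C (arcColour∈ j i)

    disjoint : ∀ j j' i i' → cycle j i ≡ cycle j' i' → j ≡ j'
    disjoint j j' i i' e = disjointV j j' _ (subst (_∈ proj₁ (edge j)) e (vertex∈ j i)) (vertex∈ j' i')

    covers : ∀ x → x ∈ V → ∃ λ j → ∃ λ i → cycle j i ≡ x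
    covers x x∈V = let (j , x∈v) = coversV x x∈V ; (_ , _ , _ , _ , covered , _) = isEdge j in
      j , covered x x∈v

    rainbow : ∀ j j' i i' → arcColour G (cycle j) i ≡ arcColour G (cycle j') i' → j ≡ j' × i ≡ i'
    rainbow j j' i i' e
      with disjointC j j' _ (arcColour∈ j i) (subst (_∈ proj₂ (edge j')) (sym e) (arcColour∈ j' i'))
    ... | refl = let (_ , _ , _ , (_ , colour-inj) , _) = isEdge j in refl , colour-inj e

  ColoursUsed : RainbowFactor G k V C → Set
  ColoursUsed rf = ∀ c → c ∈ C → ∃₂ λ j i → arcColour G (RainbowFactor.cyc rf j) i ≡ c

  rainbowFactor⇒perfectMatching : (rf : RainbowFactor G k V C) → ColoursUsed rf → PerfectMatching G k V C
  rainbowFactor⇒perfectMatching rf colours-used = record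
    { m = m ; edge = edge ; isEdge = isEdge
    ; disjointV = disjointV ; disjointC = disjointC ; coversV = coversV ; coversC = coversC }
    where
    open RainbowFactor rf

    edge : Fin m → Subset (n G) × Subset (n G)
    edge j = image (cyc j) , image (arcColour G (cyc j))

    isEdge : ∀ j → IsHyperedge G k V C (edge j)
    isEdge j =
        (λ x∈ → let (i , e) = ∈-image⁻ (cyc j) x∈ ; (v∈V , _) = proj₂ (isCycle j) i in
                subst (_∈ V) e v∈V)
      , (λ c∈ → let (i , e) = ∈-image⁻ _ c∈ ; (_ , _ , _ , c∈C) = proj₂ (isCycle j) i in
                subst (_∈ C) e c∈C)
      , cyc j
      , (  (proj₁ (isCycle j) , λ i → let (_ , _ , v≢v' , _) = proj₂ (isCycle j) i in
                                       ∈⊤ , ∈⊤ , v≢v' , ∈⊤)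
         , λ e → proj₂ (rainbow j j _ _ e))
      , (λ x → ∈-image⁻ (cyc j)) , ∈-image⁺ (cyc j)
      , (λ c → ∈-image⁻ (arcColour G (cyc j))) , ∈-image⁺ (arcColour G (cyc j))

    disjointV : ∀ j j' x → x ∈ proj₁ (edge j) → x ∈ proj₁ (edge j') → j ≡ j'
    disjointV j j' x x∈ x∈' =
      let (i , e) = ∈-image⁻ (cyc j) x∈ ; (i' , e') = ∈-image⁻ (cyc j') x∈' in
      disjoint j j' i i' (trans e (sym e'))

    disjointC : ∀ j j' c → c ∈ proj₂ (edge j) → c ∈ proj₂ (edge j') → j ≡ j'
    disjointC j j' c c∈ c∈' =
      let (i , e) = ∈-image⁻ _ c∈ ; (i' , e') = ∈-image⁻ _ c∈' in
      proj₁ (rainbow j j' i i' (trans e (sym e')))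

    coversV : ∀ x → x ∈ V → ∃ λ j → x ∈ proj₁ (edge j)
    coversV x x∈V = let (j , i , e) = covers x x∈V in j , subst (_∈ image (cyc j)) e (∈-image⁺ (cyc j) i)

    coversC : ∀ c → c ∈ C → ∃ λ j → c ∈ proj₂ (edge j)
    coversC c c∈C = let (j , i , e) = colours-used c c∈C in
      j , subst (_∈ image (arcColour G (cyc j))) e (∈-image⁺ _ i)

-- Each orbit is represented by its point with the least index in Fin N.
module OrbitDecomposition
  {N k : ℕ} (f : Fin N → Fin N) {P : Pred (Fin N) 0ℓ} (P? : Decidable P)
  (f-preserves : ∀ {x} → P x → P (f x)) (periodic : ∀ {x} → P x → iter (suc k) f x ≡ x)
  where

  private
    K = suc k

  orbit : Fin N → Fin K → Fin N
  orbit x i = iter (toℕ i) f x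

  orbit-index : ∀ {x} → P x → ∀ a → ∃ λ i → orbit x i ≡ iter a f x
  orbit-index {x} Px a = fromℕ< (m%n<n a K) ,
    trans (cong (λ t → iter t f x) (toℕ-fromℕ< (m%n<n a K))) (sym (iter-% K (periodic Px) a))

  orbit-sucMod : ∀ {x} → P x → ∀ i → orbit x (sucMod i) ≡ f (orbit x i)
  orbit-sucMod {x} Px i =
    trans (cong (λ t → iter t f x) (toℕ-sucMod i)) (sym (iter-% K (periodic Px) (suc (toℕ i))))

  IsRepresentative : Pred (Fin N) 0ℓ
  IsRepresentative x = P x × ∀ i → toℕ x ≤ toℕ (orbit x i)

  isRepresentative? : Decidable IsRepresentative
  isRepresentative? x = P? x ×-dec all? (λ i → toℕ x ≤? toℕ (orbit x i))

  representative-least : ∀ {x} → IsRepresentative x → ∀ a → toℕ x ≤ toℕ (iter a f x)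
  representative-least {x} (Px , least) a =
    let (i , e) = orbit-index Px a in subst (λ y → toℕ x ≤ toℕ y) e (least i)

  representative-unique : ∀ {x y} → IsRepresentative x → IsRepresentative y →
                          ∀ i j → orbit x i ≡ orbit y j → x ≡ y
  representative-unique Rx Ry i j e = toℕ-injective (≤-antisym (x≤ Rx Ry i j e) (x≤ Ry Rx j i (sym e)))
    where
    x≤ : ∀ {x y} → IsRepresentative x → IsRepresentative y →
         ∀ i j → orbit x i ≡ orbit y j → toℕ x ≤ toℕ y
    x≤ {x} Rx (Py , _) i j e = subst (λ z → toℕ x ≤ toℕ z)
      (iter-rewind {f = f} K (toℕ i) (toℕ j) (<⇒≤ (toℕ<n j)) (periodic Py) e)
      (representative-least Rx (K ∸ toℕ j + toℕ i))

  minimal-representative : ∀ {x} → P x → ∃ λ i → IsRepresentative (orbit x i)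
  minimal-representative {x} Px = i₀ , iter-preserves (toℕ i₀) {P} f-preserves Px , least
    where
    minimum = minimum-attained (λ i → toℕ (orbit x i))
    i₀ = proj₁ minimum
    least : ∀ i → toℕ (orbit x i₀) ≤ toℕ (orbit (orbit x i₀) i)
    least i = let (i' , e) = orbit-index Px (toℕ i + toℕ i₀) in
      subst (λ y → toℕ (orbit x i₀) ≤ toℕ y) (trans e (iter-+ (toℕ i) (toℕ i₀) f x))
            (proj₂ minimum i')

  representatives : List (Fin N)
  representatives = filter isRepresentative? (allFin N)

  m : ℕ
  m = length representatives

  rep : Fin m → Fin N
  rep = lookup representatives

  rep-isRepresentative : ∀ j → IsRepresentative (rep j)
  rep-isRepresentative j = proj₂ (∈-filter⁻ isRepresentative? {xs = allFin N} (∈-lookup j))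

  rep-P : ∀ j → P (rep j)
  rep-P j = proj₁ (rep-isRepresentative j)

  rep-surjective : ∀ {x} → IsRepresentative x → ∃ λ j → rep j ≡ x
  rep-surjective {x} Rx = Any.index x∈ , sym (lookup-index x∈)
    where x∈ = ∈-filter⁺ isRepresentative? (∈-allFin x) Rx

  orbits-disjoint : ∀ j j' i i' → orbit (rep j) i ≡ orbit (rep j') i' → j ≡ j'
  orbits-disjoint j j' i i' e = lookup-injective representatives (filter⁺ isRepresentative? (allFin⁺ N))
    (representative-unique (rep-isRepresentative j) (rep-isRepresentative j') i i' e)

  orbits-cover : ∀ {x} → P x → ∃ λ j → ∃ λ i → orbit (rep j) i ≡ x
  orbits-cover {x} Px = j , i , trans e (trans (cong (iter (K ∸ toℕ i₀ + 0) f) rep-j≡r) back)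
    where
    min = minimal-representative Px
    i₀ = proj₁ min
    r = orbit x i₀
    j = proj₁ (rep-surjective (proj₂ min))
    rep-j≡r = proj₂ (rep-surjective (proj₂ min))
    back : iter (K ∸ toℕ i₀ + 0) f r ≡ x
    back = iter-rewind {f = f} K 0 (toℕ i₀) (<⇒≤ (toℕ<n i₀)) (periodic Px) refl
    i = proj₁ (orbit-index (rep-P j) (K ∸ toℕ i₀ + 0))
    e = proj₂ (orbit-index (rep-P j) (K ∸ toℕ i₀ + 0))

module FromRainbowFactor (G : FinAbGroup) {k : ℕ} (rf : RainbowFactor G (suc k) (G∖0 G) (G∖0 G)) where
  open RainbowFactor rf
  private
    module G = FinAbGroup G
    K = suc k

  cyc-injective : ∀ j → Injective _≡_ _≡_ (cyc j)
  cyc-injective j = proj₁ (isCycle j)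

  cyc≢0 : ∀ j i → cyc j i ≢ G.0#
  cyc≢0 j i = ∈G∖0⁻ G (proj₁ (proj₂ (isCycle j) i))

  arcColour≢0 : ∀ j i → arcColour G (cyc j) i ≢ G.0#
  arcColour≢0 j i = let (_ , _ , _ , c∈) = proj₂ (isCycle j) i in ∈G∖0⁻ G c∈

  data Position : Fin (n G) → Set where
    zero   : Position G.0#
    vertex : ∀ j i → Position (cyc j i)

  position : ∀ x → Position x
  position x with x ≟ G.0#
  ... | yes refl = zero
  ... | no  x≢0 with covers x (∈G∖0⁺ G x≢0)
  ...   | j , i , refl = vertex j i

  φ : Fin (n G) → Fin (n G)
  φ x with x ≟ G.0#
  ... | yes _   = G.0#
  ... | no  x≢0 = let (j , i , _) = covers x (∈G∖0⁺ G x≢0) in cyc j (sucMod i)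

  φ-0 : φ G.0# ≡ G.0#
  φ-0 with G.0# ≟ G.0#
  ... | yes _   = refl
  ... | no  0≢0 = ⊥-elim (0≢0 refl)

  cyc-injective₂ : ∀ j j' i i' → cyc j i ≡ cyc j' i' → j ≡ j' × i ≡ i'
  cyc-injective₂ j j' i i' e with disjoint j j' i i' e
  ... | refl = refl , cyc-injective j e

  φ-vertex : ∀ j i → φ (cyc j i) ≡ cyc j (sucMod i)
  φ-vertex j i with cyc j i ≟ G.0#
  ... | yes v≡0 = ⊥-elim (cyc≢0 j i v≡0)
  ... | no  v≢0 with covers (cyc j i) (∈G∖0⁺ G v≢0)
  ...   | j' , i' , e with cyc-injective₂ j' j i' i e
  ...     | refl , refl = refl

  φ-injective : Injective _≡_ _≡_ φ
  φ-injective {x} {y} = go (position x) (position y)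
    where
    go : ∀ {x y} → Position x → Position y → φ x ≡ φ y → x ≡ y
    go zero zero _ = refl
    go zero (vertex j i) e = ⊥-elim (cyc≢0 j (sucMod i) (trans (sym (φ-vertex j i)) (trans (sym e) φ-0)))
    go (vertex j i) zero e = ⊥-elim (cyc≢0 j (sucMod i) (trans (sym (φ-vertex j i)) (trans e φ-0)))
    go (vertex j i) (vertex j' i') e
      with cyc-injective₂ j j' _ _ (trans (sym (φ-vertex j i)) (trans e (φ-vertex j' i')))
    ... | refl , next≡next' = cong (cyc j) (sucMod-injective next≡next')

  ψ : Fin (n G) → Fin (n G)
  ψ x = colour G (φ x) x

  ψ-0 : ψ G.0# ≡ G.0#
  ψ-0 = trans (cong (λ t → colour G t G.0#) φ-0) (colour-self G G.0#)

  ψ-vertex : ∀ j i → ψ (cyc j i) ≡ G.- arcColour G (cyc j) i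
  ψ-vertex j i = trans (cong (λ t → colour G t (cyc j i)) (φ-vertex j i)) (sym (-colour G _ _))

  ψ-injective : Injective _≡_ _≡_ ψ
  ψ-injective {x} {y} = go (position x) (position y)
    where
    go : ∀ {x y} → Position x → Position y → ψ x ≡ ψ y → x ≡ y
    go zero zero _ = refl
    go zero (vertex j i) e =
      ⊥-elim (arcColour≢0 j i (-x≡0⇒x≡0 G (trans (sym (ψ-vertex j i)) (trans (sym e) ψ-0))))
    go (vertex j i) zero e =
      ⊥-elim (arcColour≢0 j i (-x≡0⇒x≡0 G (trans (sym (ψ-vertex j i)) (trans e ψ-0))))
    go (vertex j i) (vertex j' i') e
      with rainbow j j' i i' (-‿injective G (trans (sym (ψ-vertex j i)) (trans e (ψ-vertex j' i'))))
    ... | refl , refl = refl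

  iter-φ-vertex : ∀ t j i → iter t φ (cyc j i) ≡ cyc j (iter t sucMod i)
  iter-φ-vertex t j = iter-natural t (cyc j) (φ-vertex j)

  orthomorphism : HasOrthomorphismKCycles G K
  orthomorphism = φ , (injective⇒bijective φ-injective , injective⇒bijective ψ-injective) , φ-0 ,
                  λ x x≢0 → kCycle (position x) x≢0
    where
    kCycle : ∀ {x} → Position x → x ≢ G.0# →
             iter K φ x ≡ x × (∀ t → 1 ≤ t → t < K → iter t φ x ≢ x)
    kCycle zero 0≢0 = ⊥-elim (0≢0 refl)
    kCycle (vertex j i) _ =
        trans (iter-φ-vertex K j i) (cong (cyc j) (iter-sucMod-period i))
      , λ t 1≤t t<K e →
          iter-sucMod-aperiodic t 1≤t t<K i (cyc-injective j (trans (sym (iter-φ-vertex t j i)) e))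

  -- ψ is a bijection fixing 0, and at a vertex it is minus the colour of the outgoing arc.
  coloursUsed : ColoursUsed G rf
  coloursUsed c c∈ = let (x , ψx≡-c) = injective⇒strictlySurjective ψ-injective (G.- c) in
    used (position x) ψx≡-c
    where
    used : ∀ {x} → Position x → ψ x ≡ G.- c → ∃₂ λ j i → arcColour G (cyc j) i ≡ c
    used zero e = ⊥-elim (∈G∖0⁻ G c∈ (-x≡0⇒x≡0 G (trans (sym e) ψ-0)))
    used (vertex j i) e = j , i , -‿injective G (trans (sym (ψ-vertex j i)) e)

module FromOrthomorphism
  (G : FinAbGroup) {k : ℕ} (1<K : 1 < suc k) (orth : HasOrthomorphismKCycles G (suc k))
  where
  private
    module G = FinAbGroup G
    K = suc k

  φ : Fin (n G) → Fin (n G)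
  φ = proj₁ orth

  φ-injective : Injective _≡_ _≡_ φ
  φ-injective = proj₁ (proj₁ (proj₁ (proj₂ orth)))

  ψ : Fin (n G) → Fin (n G)
  ψ x = colour G (φ x) x

  ψ-injective : Injective _≡_ _≡_ ψ
  ψ-injective = proj₁ (proj₂ (proj₁ (proj₂ orth)))

  φ-0 : φ G.0# ≡ G.0#
  φ-0 = proj₁ (proj₂ (proj₂ orth))

  periodic : ∀ {x} → x ≢ G.0# → iter K φ x ≡ x
  periodic {x} x≢0 = proj₁ (proj₂ (proj₂ (proj₂ orth)) x x≢0)

  aperiodic : ∀ {x} → x ≢ G.0# → ∀ t → 1 ≤ t → t < K → iter t φ x ≢ x
  aperiodic {x} x≢0 = proj₂ (proj₂ (proj₂ (proj₂ orth)) x x≢0)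

  φ-preserves-≢0 : ∀ {x} → x ≢ G.0# → φ x ≢ G.0#
  φ-preserves-≢0 x≢0 φx≡0 = x≢0 (φ-injective (trans φx≡0 (sym φ-0)))

  open OrbitDecomposition {k = k} φ (λ x → ¬? (x ≟ G.0#)) φ-preserves-≢0 periodic

  cycle : Fin m → Fin K → Fin (n G)
  cycle j = orbit (rep j)

  cycle-injective : ∀ j → Injective _≡_ _≡_ (cycle j)
  cycle-injective j = orbit-injective φ-injective (aperiodic (rep-P j))

  cycle≢0 : ∀ j i → cycle j i ≢ G.0#
  cycle≢0 j i = iter-preserves (toℕ i) {λ x → x ≢ G.0#} φ-preserves-≢0 (rep-P j)

  cycle-sucMod : ∀ j i → cycle j (sucMod i) ≡ φ (cycle j i)
  cycle-sucMod j = orbit-sucMod (rep-P j)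

  x≢φx : ∀ {x} → x ≢ G.0# → x ≢ φ x
  x≢φx x≢0 e = aperiodic x≢0 1 ≤-refl 1<K (sym e)

  cycle-injective₂ : ∀ j j' i i' → cycle j i ≡ cycle j' i' → j ≡ j' × i ≡ i'
  cycle-injective₂ j j' i i' e with orbits-disjoint j j' i i' e
  ... | refl = refl , cycle-injective j e

  arcColour-cycle : ∀ j i → arcColour G (cycle j) i ≡ G.- ψ (cycle j i)
  arcColour-cycle j i = trans (cong (colour G (cycle j i)) (cycle-sucMod j i)) (sym (-colour G _ _))

  rainbowFactor : RainbowFactor G K (G∖0 G) (G∖0 G)
  rainbowFactor = record
    { m = m ; cyc = cycle ; isCycle = isCycle ; disjoint = orbits-disjoint
    ; covers = λ x x∈ → orbits-cover (∈G∖0⁻ G x∈) ; rainbow = rainbow }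
    where
    isCycle : ∀ j → IsDirectedCycle G K (G∖0 G) (G∖0 G) (cycle j)
    isCycle j = cycle-injective j , λ i →
        ∈G∖0⁺ G (cycle≢0 j i) , ∈G∖0⁺ G (cycle≢0 j (sucMod i))
      , (λ e → x≢φx (cycle≢0 j i) (trans e (cycle-sucMod j i)))
      , ∈G∖0⁺ G (λ colour≡0 →
          x≢φx (cycle≢0 j i) (trans (colour≡0⇒≡ G _ _ colour≡0) (cycle-sucMod j i)))

    rainbow : ∀ j j' i i' → arcColour G (cycle j) i ≡ arcColour G (cycle j') i' → j ≡ j' × i ≡ i'
    rainbow j j' i i' e = cycle-injective₂ j j' i i'
      (ψ-injective (-‿injective G (trans (sym (arcColour-cycle j i)) (trans e (arcColour-cycle j' i')))))

proposition2p2 : (G : FinAbGroup) (k : ℕ) → 2 ≤ k →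
    (HasOrthomorphismKCycles G k ⇔ RainbowFactor G k (G∖0 G) (G∖0 G)) ×
    (RainbowFactor G k (G∖0 G) (G∖0 G) ⇔ PerfectMatching G k (G∖0 G) (G∖0 G))
proposition2p2 G (suc k) 2≤k =
    mk⇔ (FromOrthomorphism.rainbowFactor G 2≤k) (FromRainbowFactor.orthomorphism G)
  , mk⇔ (λ rf → rainbowFactor⇒perfectMatching G rf (FromRainbowFactor.coloursUsed G rf))
        (perfectMatching⇒rainbowFactor G)
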